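{- Let $X$ be a countably based topological space, let $B_0=\emptyset,B_1,\ldots$ enumerate a countable base of $X$ (with $B_0=\emptyset$), let $\pi:\mathcal{N}\to{\bf\Sigma}^0_1(X)$ be $\pi(a)=\bigcup_nB_{a(n)}$, and let $\mathcal{A}\subseteq{\bf\Sigma}^0_1(X)$. Then $\pi^{ -1}(\mathcal{A})$ is clopen in $\mathcal{N}$ iff $\mathcal{A}=\emptyset$ or $\mathcal{A}={\bf\Sigma}^0_1(X)$.
   Context: $\mathcal{N}=\omega^\omega$ is the Baire space and ${\bf\Sigma}^0_1(X)$ is the set of open subsets of $X$. -}

module Defs where

open import Level using (0ℓ)
open import Data.Nat using (ℕ; _<_)
open import Data.Product using (Σ; ∃; _×_; proj₁; proj₂; _,_)
open import Data.Sum using (_⊎_)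
open import Relation.Nullary using (¬_)
open import Relation.Binary.PropositionalEquality using (_≡_)
open import Relation.Unary using (Pred; _∈_; _⊆_; _∩_; U)

_≐_ : {X : Set} → Pred X 0ℓ → Pred X 0ℓ → Set
A ≐ B = (A ⊆ B) × (B ⊆ A)

⋃[_] : {X I : Set} → (I → Pred X 0ℓ) → Pred X 0ℓ
⋃[_] {I = I} F x = ∃ λ (i : I) → F i x

record TopSpace : Set₁ where
  field
    Carrier  : Set
    IsOpen   : Pred Carrier 0ℓ → Set
    open-ext : ∀ {A B} → A ≐ B → IsOpen A → IsOpen B
    open-U   : IsOpen U
    open-∩   : ∀ {A B} → IsOpen A → IsOpen B → IsOpen (A ∩ B)
    open-⋃   : (I : Set) (F : I → Pred Carrier 0ℓ) →
               (∀ i → IsOpen (F i)) → IsOpen ⋃[ F ]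

module _ (T : TopSpace) where
  open TopSpace T

  Σ⁰₁ : Set₁
  Σ⁰₁ = Σ (Pred Carrier 0ℓ) IsOpen

  IsBase : (ℕ → Pred Carrier 0ℓ) → Set₁
  IsBase B = (∀ n → IsOpen (B n)) ×
             (∀ (V : Pred Carrier 0ℓ) → IsOpen V →
                ∀ x → x ∈ V → ∃ λ n → (x ∈ B n) × (B n ⊆ V))

  IsEnumBase : (ℕ → Pred Carrier 0ℓ) → Set₁
  IsEnumBase B = IsBase B × (∀ x → ¬ (x ∈ B 0))

  π : (B : ℕ → Pred Carrier 0ℓ) → IsEnumBase B → (ℕ → ℕ) → Σ⁰₁
  π B hB a = ⋃[ (λ n → B (a n)) ] , open-⋃ ℕ (λ n → B (a n)) (λ n → proj₁ (proj₁ hB) (a n))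

  -- a family 𝒜 ⊆ Σ⁰₁(X) (subsets of Σ⁰₁ respect extensional equality)
  Extensional : Pred Σ⁰₁ 0ℓ → Set₁
  Extensional 𝒜 = ∀ (V W : Σ⁰₁) → proj₁ V ≐ proj₁ W → 𝒜 V → 𝒜 W

𝒩 : Set
𝒩 = ℕ → ℕ

AgreeUpTo : ℕ → 𝒩 → 𝒩 → Set
AgreeUpTo k a b = ∀ i → i < k → a i ≡ b i

OpenN : Pred 𝒩 0ℓ → Set
OpenN P = ∀ a → P a → ∃ λ k → ∀ b → AgreeUpTo k a b → P b

ClosedN : Pred 𝒩 0ℓ → Set
ClosedN P = OpenN (λ a → ¬ P a)

ClopenN : Pred 𝒩 0ℓ → Set
ClopenN P = OpenN P × ClosedN P

-- A set P ⊆ 𝒩 of the form π⁻¹(𝒜) only depends on the set of values of a point: if every value of a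
-- occurs in c and vice versa, then π(a) = π(c). Such a P, when open, is upward closed for
-- "every value of a occurs in c", because a long enough prefix of a followed by all of c lies in the
-- neighbourhood of a and has the same values as c. If P is clopen, the same holds for its
-- complement, and any a, b have the common upper bound "a and b interleaved"; so P is empty or
-- everything. Finally π is onto Σ⁰₁(X) (classically, a(n) = n if Bₙ ⊆ V and 0 otherwise codes V).
module Submission where

open import Defs
open import Level using (0ℓ)
open import Data.Sum as Sum using (_⊎_; inj₁; inj₂)
open import Function using (_∘_)
open import Data.Product using (_×_; _,_; proj₁; proj₂; ∃)
open import Relation.Nullary using (¬_; Dec; yes; no; contradiction)
open import Relation.Nullary.Decidable using (decidable-stable)
open import Relation.Unary using (Pred; _⊆_)
open import Axiom.ExcludedMiddle using (ExcludedMiddle)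
open import Data.Nat using (ℕ; zero; suc; _+_; s≤s)
open import Relation.Binary.PropositionalEquality using (_≡_; refl; sym; subst)

infix 4 _⊑_

_⊑_ : 𝒩 → 𝒩 → Set
a ⊑ c = ∀ n → ∃ λ m → a n ≡ c m

RangeInvariant : Pred 𝒩 0ℓ → Set
RangeInvariant P = ∀ {a c} → a ⊑ c → c ⊑ a → P a → P c

RangeInvariant-¬ : ∀ {P} → RangeInvariant P → RangeInvariant (λ a → ¬ P a)
RangeInvariant-¬ inv a⊑c c⊑a ¬Pa Pc = ¬Pa (inv c⊑a a⊑c Pc)

prefix : ℕ → 𝒩 → 𝒩 → 𝒩
prefix zero    a c         = c
prefix (suc k) a c zero    = a 0
prefix (suc k) a c (suc i) = prefix k (λ i → a (suc i)) c i

prefix-agree : ∀ k a c → AgreeUpTo k a (prefix k a c)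
prefix-agree (suc k) a c zero    _       = refl
prefix-agree (suc k) a c (suc i) (s≤s p) = prefix-agree k (λ i → a (suc i)) c i p

prefix-shift : ∀ k a c j → prefix k a c (k + j) ≡ c j
prefix-shift zero    a c j = refl
prefix-shift (suc k) a c j = prefix-shift k (λ i → a (suc i)) c j

prefix-⊑ : ∀ k {a c} → a ⊑ c → prefix k a c ⊑ c
prefix-⊑ zero    a⊑c n       = n , refl
prefix-⊑ (suc k) a⊑c zero    = a⊑c 0
prefix-⊑ (suc k) a⊑c (suc n) = prefix-⊑ k (λ i → a⊑c (suc i)) n

⊑-prefix : ∀ k a c → c ⊑ prefix k a c
⊑-prefix k a c j = k + j , sym (prefix-shift k a c j)

interleave : 𝒩 → 𝒩 → 𝒩
interleave a b zero          = a 0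
interleave a b (suc zero)    = b 0
interleave a b (suc (suc n)) = interleave (λ i → a (suc i)) (λ i → b (suc i)) n

⊑-interleaveˡ : ∀ a b → a ⊑ interleave a b
⊑-interleaveˡ a b zero    = 0 , refl
⊑-interleaveˡ a b (suc j) with ⊑-interleaveˡ (λ i → a (suc i)) (λ i → b (suc i)) j
... | i , eq = suc (suc i) , eq

⊑-interleaveʳ : ∀ a b → b ⊑ interleave a b
⊑-interleaveʳ a b zero    = 1 , refl
⊑-interleaveʳ a b (suc j) with ⊑-interleaveʳ (λ i → a (suc i)) (λ i → b (suc i)) j
... | i , eq = suc (suc i) , eq

open∧RangeInvariant⇒⊑-closed : ∀ {P} → OpenN P → RangeInvariant P →
                                 ∀ {a c} → a ⊑ c → P a → P c
open∧RangeInvariant⇒⊑-closed {P} isOpen inv {a} {c} a⊑c Pa with isOpen a Pa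
... | k , nbhd = inv (prefix-⊑ k a⊑c) (⊑-prefix k a c) (nbhd (prefix k a c) (prefix-agree k a c))

clopen∧RangeInvariant⇒constant : ∀ {P} → ClopenN P → RangeInvariant P → ∀ {a b} → P a → ¬ ¬ P b
clopen∧RangeInvariant⇒constant (isOpen , isClosed) inv {a} {b} Pa ¬Pb =
  contradiction (open∧RangeInvariant⇒⊑-closed isOpen inv (⊑-interleaveˡ a b) Pa)
                (open∧RangeInvariant⇒⊑-closed isClosed (RangeInvariant-¬ inv) (⊑-interleaveʳ a b) ¬Pb)

trivial⇒clopen : ∀ {P} → (∀ a → ¬ P a) ⊎ (∀ a → P a) → ClopenN P
trivial⇒clopen (inj₁ none) = (λ a Pa → contradiction Pa (none a)) , (λ _ _ → 0 , λ b _ → none b)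
trivial⇒clopen (inj₂ all)  = (λ _ _ → 0 , λ b _ → all b) , (λ a ¬Pa → contradiction (all a) ¬Pa)

module BaseCoding (T : TopSpace) (B : ℕ → Pred (TopSpace.Carrier T) 0ℓ) (hB : IsEnumBase T B) where
  open TopSpace T

  private
    ⋃B : 𝒩 → Pred Carrier 0ℓ
    ⋃B a = proj₁ (π T B hB a)

  π-mono : ∀ {a c} → a ⊑ c → ⋃B a ⊆ ⋃B c
  π-mono a⊑c {x} (n , x∈B) with a⊑c n
  ... | m , eq = m , subst (λ i → B i x) eq x∈B

  π⁻¹-RangeInvariant : ∀ {𝒜} → Extensional T 𝒜 → RangeInvariant (λ a → 𝒜 (π T B hB a))
  π⁻¹-RangeInvariant ext a⊑c c⊑a = ext _ _ (π-mono a⊑c , π-mono c⊑a)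

  module Classical (lem : ExcludedMiddle 0ℓ) where

    private
      -- B 0 = ∅ makes 0 a harmless index for the base sets not contained in V.
      index-if-⊆ : (V : Pred Carrier 0ℓ) → ∀ n → Dec (B n ⊆ V) → ℕ
      index-if-⊆ V n (yes _) = n
      index-if-⊆ V n (no _)  = 0

      index-if-⊆-⊆ : ∀ V n d → B (index-if-⊆ V n d) ⊆ V
      index-if-⊆-⊆ V n (yes Bn⊆V) x∈B = Bn⊆V x∈B
      index-if-⊆-⊆ V n (no _)     {x} x∈B = contradiction x∈B (proj₂ hB x)

      index-if-⊆-yes : ∀ V n → B n ⊆ V → ∀ d → index-if-⊆ V n d ≡ n
      index-if-⊆-yes V n _     (yes _)     = refl
      index-if-⊆-yes V n Bn⊆V (no Bn⊈V) = contradiction (λ {x} → Bn⊆V {x}) Bn⊈V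

    code : Σ⁰₁ T → 𝒩
    code (V , _) n = index-if-⊆ V n lem

    π-code : ∀ V → proj₁ V ≐ ⋃B (code V)
    π-code (V , V-open) = ⊆-code , λ { (n , x∈B) → index-if-⊆-⊆ V n lem x∈B }
      where
      ⊆-code : V ⊆ ⋃B (code (V , V-open))
      ⊆-code {x} x∈V with proj₂ (proj₁ hB) V V-open x x∈V
      ... | n , x∈Bn , Bn⊆V = n , subst (λ i → B i x) (sym (index-if-⊆-yes V n Bn⊆V lem)) x∈Bn

proposition6p6 : ExcludedMiddle 0ℓ →
    (T : TopSpace) (B : ℕ → Pred (TopSpace.Carrier T) 0ℓ) (hB : IsEnumBase T B)
    (𝒜 : Pred (Σ⁰₁ T) 0ℓ) → Extensional T 𝒜 →
    (ClopenN (λ a → 𝒜 (π T B hB a)) →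
       ((∀ V → ¬ 𝒜 V) ⊎ (∀ V → 𝒜 V)))
    × (((∀ V → ¬ 𝒜 V) ⊎ (∀ V → 𝒜 V)) →
       ClopenN (λ a → 𝒜 (π T B hB a)))
proposition6p6 lem T B hB 𝒜 ext = clopen⇒trivial , trivial⇒clopen ∘ pull-back
  where
  open BaseCoding T B hB
  open Classical lem

  from-code : ∀ V → 𝒜 (π T B hB (code V)) → 𝒜 V
  from-code V = ext _ V (proj₂ (π-code V) , proj₁ (π-code V))

  to-code : ∀ V → 𝒜 V → 𝒜 (π T B hB (code V))
  to-code V = ext V _ (π-code V)

  constant : ClopenN (λ a → 𝒜 (π T B hB a)) → ∀ {a b} → 𝒜 (π T B hB a) → ¬ ¬ 𝒜 (π T B hB b)
  constant clopen = clopen∧RangeInvariant⇒constant clopen (π⁻¹-RangeInvariant ext)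

  pull-back : (∀ V → ¬ 𝒜 V) ⊎ (∀ V → 𝒜 V) → (∀ a → ¬ 𝒜 (π T B hB a)) ⊎ (∀ a → 𝒜 (π T B hB a))
  pull-back = Sum.map (λ none a → none (π T B hB a)) (λ all a → all (π T B hB a))

  clopen⇒trivial : ClopenN (λ a → 𝒜 (π T B hB a)) → (∀ V → ¬ 𝒜 V) ⊎ (∀ V → 𝒜 V)
  clopen⇒trivial clopen with lem {𝒜 (π T B hB (λ _ → 0))}
  ... | yes 𝒜π0 = inj₂ λ V → from-code V (decidable-stable lem (constant clopen 𝒜π0))
  ... | no ¬𝒜π0 = inj₁ λ V 𝒜V → constant clopen (to-code V 𝒜V) ¬𝒜π0
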